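{- Let $k\ge 4$ be an integer. There exist $\theta>\log_2 3$ and $a,b\in\mathbb R$ (depending on $k$) such that the following holds. Let $\vec F$ be a $\vec T_k$-free $k$-PDG on $k+1$ vertices, and let $(x_1,\dots,x_{k-1},y,z)$ be a uniformly random ordering of the vertices of $\vec F$. Write $x=x_1\cdots x_{k-1}$; let $xy$ be the event that $\{x_1,\dots,x_{k-1},y\}$ is an undirected edge of $\vec F$, $x\check y$ the event that $\{x_1,\dots,x_{k-1},y\}$ is a directed edge of $\vec F$ directed toward $y$, and $\underline{xy}$ the event that there is no edge on $\{x_1,\dots,x_{k-1},y\}$; define $x\check z$, $\underline{xz}$ analogously with $z$ in place of $y$. Then \[\mathbb P(xy)+k\theta\,\mathbb P(x\check y)+a^2\,\mathbb P(\underline{xy}\wedge\underline{xz})-2ab\,\mathbb P(\underline{xy}\wedge x\check z)+b^2\,\mathbb P(x\check y\wedge x\check z)\le 1.\]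
   Context: A partially directed $k$-graph ($k$-PDG) on a vertex set $V$ specifies for each $k$-subset $S\subseteq V$ exactly one of: no edge on $S$; an undirected edge on $S$; or a directed edge on $S$ directed toward a chosen vertex of $S$. $\vec T$ is a subgraph of $\vec F$ if a $k$-PDG isomorphic to $\vec T$ can be obtained from $\vec F$ by deleting edges, deleting vertices and forgetting directions of edges; $\vec F$ is $\vec T$-free otherwise. $\vec T_k$ is the $k$-PDG on $\{1,\dots,k+1\}$ with undirected edges $\{1,\dots,k\}$, $\{2,\dots,k+1\}$ and the edge $\{1,\dots,k-1,k+1\}$ directed toward $k+1$. -}

module Defs where

open import Data.Nat as ℕ using (ℕ; zero; suc; _^_; _<_)
open import Data.Bool using (Bool; true; false; if_then_else_; _∧_)
import Data.Bool.Properties as BoolP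
open import Data.Fin as Fin using (Fin; fromℕ; inject₁)
open import Data.Fin.Properties using (any?; fromℕ≢inject₁)
import Data.Fin.Properties as FinP
open import Data.Fin.Subset using (Subset; _∈_; ∁; ⁅_⁆; ∣_∣)
open import Data.Fin.Subset.Properties using (_∈?_; x∉p⇒x∈∁p; x∈⁅y⁆⇒x≡y)
open import Data.Vec using (tabulate)
open import Data.Vec.Properties using (≡-dec)
open import Data.List using (List; map; allFin)
open import Data.Nat.ListAction using (sum)
open import Data.Integer using (+_)
open import Data.Rational using (ℚ; _/_; 0ℚ; ↥_; ↧ₙ_)
open import Data.Product using (Σ; ∃; _×_; _,_)
open import Data.Unit using (⊤)
open import Data.Empty using (⊥)
open import Function.Definitions using (Injective)
open import Relation.Nullary using (¬_; does; yes; no)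
open import Relation.Nullary.Decidable using (_×-dec_)
open import Relation.Binary.PropositionalEquality using (_≡_; _≢_; refl; sym; subst)

-- Only the values on
-- k-subsets (∣ S ∣ ≡ k) are ever consulted (see _⊑_ and the events below).

data EdgeType (n : ℕ) : Set where
  none       : EdgeType n
  undirected : EdgeType n
  directed   : Fin n → EdgeType n

record PDG (k n : ℕ) : Set where
  field
    edge   : Subset n → EdgeType n
    dir-in : ∀ S v → edge S ≡ directed v → v ∈ S

open PDG public

image : ∀ {m n} → (Fin m → Fin n) → Subset m → Subset n
image φ S = tabulate (λ j → does (any? (λ i → FinP._≟_ (φ i) j ×-dec (i ∈? S))))

-- An edge of T (on S) is realised in F (on φ[S]) after deleting edges and
-- forgetting directions: no edge needs nothing; an undirected edge needs
-- some edge (undirected or directed); a directed edge toward v needs an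
-- edge directed toward φ v.
Realised : ∀ {m n} → (Fin m → Fin n) → EdgeType m → EdgeType n → Set
Realised φ none         e = ⊤
Realised φ undirected   e = e ≢ none
Realised φ (directed v) e = e ≡ directed (φ v)

_⊑_ : ∀ {k m n} → PDG k m → PDG k n → Set
_⊑_ {k} {m} {n} T F =
  Σ (Fin m → Fin n) λ φ → Injective _≡_ _≡_ φ ×
    (∀ S → ∣ S ∣ ≡ k → Realised φ (edge T S) (edge F (image φ S)))

_-free : ∀ {k m n} → PDG k n → PDG k m → Set
(F -free) T = ¬ (T ⊑ F)

-- The k-PDG T_k on {1,…,k+1}; vertex i is represented by Fin index i-1.
-- For k = suc m: the edge {1,…,k} = ∁ ⁅ k+1 ⁆ and {2,…,k+1} = ∁ ⁅ 1 ⁆ are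
-- undirected, and {1,…,k-1,k+1} = ∁ ⁅ k ⁆ is directed toward k+1.
-- (k = 0 is degenerate and never used.)

_≟ₛ_ : ∀ {n} (S T : Subset n) → _
_≟ₛ_ = ≡-dec BoolP._≟_

module _ (m : ℕ) where
  private
    n = suc (suc m)
    vLast : Fin n
    vLast = fromℕ (suc m)
    vK : Fin n
    vK = inject₁ (fromℕ m)
    vOne : Fin n
    vOne = Fin.zero

  T-edge : Subset n → EdgeType n
  T-edge S with S ≟ₛ ∁ ⁅ vK ⁆
  ... | yes _ = directed vLast
  ... | no _ with S ≟ₛ ∁ ⁅ vLast ⁆
  ...   | yes _ = undirected
  ...   | no _ with S ≟ₛ ∁ ⁅ vOne ⁆
  ...     | yes _ = undirected
  ...     | no _ = none

  T-dir-in : ∀ S v → T-edge S ≡ directed v → v ∈ S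
  T-dir-in S v eq with S ≟ₛ ∁ ⁅ vK ⁆
  T-dir-in S v refl | yes refl =
    x∉p⇒x∈∁p (λ p → fromℕ≢inject₁ (x∈⁅y⁆⇒x≡y vK p))
  T-dir-in S v eq | no _ with S ≟ₛ ∁ ⁅ vLast ⁆
  T-dir-in S v () | no _ | yes _
  T-dir-in S v eq | no _ | no _ with S ≟ₛ ∁ ⁅ vOne ⁆
  T-dir-in S v () | no _ | no _ | yes _
  T-dir-in S v () | no _ | no _ | no _

T⃗ : (k : ℕ) → PDG k (suc k)
T⃗ zero    = record { edge = λ _ → none ; dir-in = λ _ _ () }
T⃗ (suc m) = record { edge = T-edge m ; dir-in = T-dir-in m }

-- Since there are exactly k+1 vertices,
-- {x₁,…,x_{k-1},y} = ∁ ⁅ z ⁆ and {x₁,…,x_{k-1},z} = ∁ ⁅ y ⁆, so every event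
-- depends only on the ordered pair (y , z), which is a uniformly random
-- ordered pair of distinct vertices.

isNone : ∀ {n} → EdgeType n → Bool
isNone none = true
isNone _    = false

isUndirected : ∀ {n} → EdgeType n → Bool
isUndirected undirected = true
isUndirected _          = false

isDirectedTo : ∀ {n} → Fin n → EdgeType n → Bool
isDirectedTo v (directed w) = does (FinP._≟_ w v)
isDirectedTo v _            = false

module Events {k n : ℕ} (F : PDG k n) where
  xy : Fin n → Fin n → Bool
  xy y z = isUndirected (edge F (∁ ⁅ z ⁆))
  xy̌ : Fin n → Fin n → Bool
  xy̌ y z = isDirectedTo y (edge F (∁ ⁅ z ⁆))
  ¬xy : Fin n → Fin n → Bool
  ¬xy y z = isNone (edge F (∁ ⁅ z ⁆))
  xž : Fin n → Fin n → Bool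
  xž y z = isDirectedTo z (edge F (∁ ⁅ y ⁆))
  ¬xz : Fin n → Fin n → Bool
  ¬xz y z = isNone (edge F (∁ ⁅ y ⁆))

_and_ : ∀ {n} → (Fin n → Fin n → Bool) → (Fin n → Fin n → Bool) → Fin n → Fin n → Bool
(P and Q) y z = P y z ∧ Q y z

countPairs : ∀ {n} → (Fin n → Fin n → Bool) → ℕ
countPairs {n} P =
  sum (map (λ y → sum (map (λ z →
    if does (FinP._≟_ y z) then 0 else (if P y z then 1 else 0)) (allFin n))) (allFin n))

Pr : ∀ {n} → (Fin n → Fin n → Bool) → ℚ
Pr {zero}        P = 0ℚ
Pr {suc zero}    P = 0ℚ
Pr {suc (suc m)} P = + countPairs P / (suc (suc m) ℕ.* suc m)

log₂3<_ : ℚ → Set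
log₂3< θ = ∃ λ p → (↥ θ ≡ + p) × (3 ^ ↧ₙ θ < 2 ^ p)

module Submission where

-- Write E v for the edge of F on the k-set missing v, so that each event for the ordered pair
-- (y , z) only involves E y and E z.  With θ = 8/5, a = 3/4, b = (8k − 5)/20 and after multiplying
-- by 400 (k + 1) k, the claim becomes an inequality between counts of ordered pairs, and charging
-- each pair to one of its vertices turns it into: the net vertex weights sum to at most 400k (k + 1).
-- Freeness of T⃗ k says that if E u is directed toward v and E v is an edge, then every other E w is
-- empty; then u and v weigh at most 640k + (8k − 5)² and the others 225 (k − 2) each.  Otherwise
-- every directed edge points to a vertex with no edge, so a directed vertex weighs 640k of which
-- 240k − 150 is cancelled by the 2ab term, an undirected vertex weighs 400k, and a vertex with no
-- edge, if there is one, weighs at most 225k, which pays for the excess 150 (k + 1).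

module FinSums where

  open import Data.Bool using (Bool; true; false; if_then_else_; _∧_)
  open import Data.Bool.Properties using (∧-zeroʳ; ∧-identityʳ)
  open import Data.Fin using (Fin; zero; suc; punchIn)
  open import Data.Fin.Properties using (_≟_; punchInᵢ≢i)
  open import Data.List using (map; allFin; tabulate)
  open import Data.List.Properties using (map-tabulate)
  import Data.Nat.ListAction as List
  open import Data.Nat using (ℕ; zero; suc; _+_; _*_; _≤_; z≤n; s≤s)
  open import Data.Nat.Properties as ℕP using (+-*-semiring)
  open import Function using (_∘_; id)
  open import Relation.Nullary using (does; yes; no)
  open import Relation.Nullary.Decidable using (dec-true; dec-false)
  open import Relation.Binary.PropositionalEquality
  open import Algebra.Properties.Semiring.Sum +-*-semiring public
    using (sum; sum-syntax; sum-cong-≗; sum-remove; sum-replicate-zero; ∑-distrib-+; ∑-comm; *-distribˡ-sum)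

  ind : Bool → ℕ
  ind b = if b then 1 else 0

  ind≤1 : ∀ b → ind b ≤ 1
  ind≤1 true  = s≤s z≤n
  ind≤1 false = z≤n

  ∑-mono-≤ : ∀ {n} {f g : Fin n → ℕ} → (∀ i → f i ≤ g i) → sum f ≤ sum g
  ∑-mono-≤ {zero}  f≤g = z≤n
  ∑-mono-≤ {suc n} f≤g = ℕP.+-mono-≤ (f≤g zero) (∑-mono-≤ (f≤g ∘ suc))

  ∑-const : ∀ n c → ∑[ i < n ] c ≡ n * c
  ∑-const zero    c = refl
  ∑-const (suc n) c = cong (c +_) (∑-const n c)

  sum-tabulate : ∀ n (f : Fin n → ℕ) → List.sum (tabulate f) ≡ sum f
  sum-tabulate zero    f = refl
  sum-tabulate (suc n) f = cong (f zero +_) (sum-tabulate n (f ∘ suc))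

  sum-allFin : ∀ n (f : Fin n → ℕ) → List.sum (map f (allFin n)) ≡ sum f
  sum-allFin n f = trans (cong List.sum (map-tabulate id f)) (sum-tabulate n f)

  except : ∀ {n} → Fin n → (Fin n → ℕ) → Fin n → ℕ
  except t f z = if does (t ≟ z) then 0 else f z

  except-self : ∀ {n} (t : Fin n) f → except t f t ≡ 0
  except-self t f rewrite dec-true (t ≟ t) refl = refl

  except-other : ∀ {n} {t z : Fin n} f → t ≢ z → except t f z ≡ f z
  except-other {t = t} {z} f t≢z rewrite dec-false (t ≟ z) t≢z = refl

  ∑-except : ∀ {n} (t : Fin n) f → sum (except t f) + f t ≡ sum f
  ∑-except {suc n} t f = begin
    sum (except t f) + f t                           ≡⟨ cong (_+ f t) (sum-remove {i = t} (except t f)) ⟩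
    except t f t + sum (except t f ∘ punchIn t) + f t ≡⟨ cong (λ x → x + sum (except t f ∘ punchIn t) + f t) (except-self t f) ⟩
    sum (except t f ∘ punchIn t) + f t               ≡⟨ cong (_+ f t) (sum-cong-≗ (λ i → except-other f (punchInᵢ≢i t i ∘ sym))) ⟩
    sum (f ∘ punchIn t) + f t                        ≡⟨ ℕP.+-comm _ (f t) ⟩
    f t + sum (f ∘ punchIn t)                        ≡⟨ sum-remove {i = t} f ⟨
    sum f                                            ∎
    where open ≡-Reasoning

  except-≤ : ∀ {n} (t : Fin n) f z → except t f z ≤ f z
  except-≤ t f z with does (t ≟ z)
  ... | true  = z≤n
  ... | false = ℕP.≤-refl

  ∑-except-const : ∀ {k} (t : Fin (suc k)) c → sum (except t (λ _ → c)) ≡ k * c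
  ∑-except-const {k} t c = ℕP.+-cancelʳ-≡ c _ _ (begin
    sum (except t (λ _ → c)) + c ≡⟨ ∑-except t (λ _ → c) ⟩
    ∑[ i < suc k ] c             ≡⟨ ∑-const (suc k) c ⟩
    c + k * c                    ≡⟨ ℕP.+-comm c (k * c) ⟩
    k * c + c                    ∎)
    where open ≡-Reasoning

  ∑-concentrated : ∀ {n} (t : Fin n) f → (∀ z → t ≢ z → f z ≡ 0) → sum f ≡ f t
  ∑-concentrated {n} t f f≡0 = begin
    sum f                    ≡⟨ ∑-except t f ⟨
    sum (except t f) + f t   ≡⟨ cong (_+ f t) (sum-cong-≗ vanish) ⟩
    ∑[ _ < n ] 0 + f t       ≡⟨ cong (_+ f t) (sum-replicate-zero n) ⟩
    f t                      ∎
    where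
    open ≡-Reasoning
    vanish : ∀ z → except t f z ≡ 0
    vanish z with t ≟ z
    ... | yes _   = refl
    ... | no  t≢z = f≡0 z t≢z

  except-zero : ∀ {n} (t : Fin n) f z → f z ≡ 0 → except t f z ≡ 0
  except-zero t f z fz≡0 = ℕP.n≤0⇒n≡0 (subst (except t f z ≤_) fz≡0 (except-≤ t f z))

  except-≤-except : ∀ {n} (t : Fin n) {f g : Fin n → ℕ} z → (t ≢ z → f z ≤ g z) → except t f z ≤ except t g z
  except-≤-except t z f≤g with t ≟ z
  ... | yes _   = z≤n
  ... | no  t≢z = f≤g t≢z

  ∑-except-ind-≤ : ∀ {k} (v : Fin (suc k)) (b : Fin (suc k) → Bool) → sum (except v (ind ∘ b)) ≤ k
  ∑-except-ind-≤ {k} v b = begin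
    sum (except v (ind ∘ b))       ≤⟨ ∑-mono-≤ (λ z → except-≤-except v {ind ∘ b} z (λ _ → ind≤1 (b z))) ⟩
    sum (except v (λ _ → 1))       ≡⟨ ∑-except-const v 1 ⟩
    k * 1                          ≡⟨ ℕP.*-identityʳ k ⟩
    k                              ∎
    where open ℕP.≤-Reasoning

  vanishing-≤-except : ∀ {n} (t : Fin n) {f g : Fin n → ℕ} z → f t ≡ 0 → (t ≢ z → f z ≤ g z) → f z ≤ except t g z
  vanishing-≤-except t {f} z ft≡0 f≤g with t ≟ z
  ... | yes refl = ℕP.≤-reflexive ft≡0
  ... | no  t≢z  = f≤g t≢z

  ∑-except-ind-≤-two-zeros : ∀ {m} {v u w : Fin (3 + m)} (b : Fin (3 + m) → Bool) →
    v ≢ u → v ≢ w → u ≢ w → b u ≡ false → b w ≡ false → sum (except v (ind ∘ b)) ≤ m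
  ∑-except-ind-≤-two-zeros {m} {v} {u} {w} b v≢u v≢w u≢w bu≡false bw≡false = ℕP.+-cancelʳ-≤ 2 _ m (begin
    sum f + 2              ≤⟨ ℕP.+-monoˡ-≤ 2 (∑-mono-≤ f≤g₃) ⟩
    sum g₃ + 2             ≡⟨ ℕP.+-assoc (sum g₃) 1 1 ⟨
    sum g₃ + 1 + 1         ≡⟨ cong₂ (λ x y → sum g₃ + x + y) g₂w≡1 g₁u≡1 ⟨
    sum g₃ + g₂ w + g₁ u   ≡⟨ cong (_+ g₁ u) (∑-except w g₂) ⟩
    sum g₂ + g₁ u          ≡⟨ ∑-except u g₁ ⟩
    sum g₁                 ≡⟨ trans (∑-except-const v 1) (ℕP.*-identityʳ (2 + m)) ⟩
    2 + m                  ≡⟨ ℕP.+-comm 2 m ⟩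
    m + 2                  ∎)
    where
    open ℕP.≤-Reasoning
    f g₁ g₂ g₃ : Fin (3 + m) → ℕ
    f  = except v (ind ∘ b)
    g₁ = except v (λ _ → 1)
    g₂ = except u g₁
    g₃ = except w g₂
    f≤g₃ : ∀ z → f z ≤ g₃ z
    f≤g₃ z = vanishing-≤-except w {f} {g₂} z (except-zero v (ind ∘ b) w (cong ind bw≡false)) λ _ →
             vanishing-≤-except u {f} {g₁} z (except-zero v (ind ∘ b) u (cong ind bu≡false)) λ _ →
             except-≤-except v {ind ∘ b} z λ _ → ind≤1 (b z)
    g₁u≡1 : g₁ u ≡ 1
    g₁u≡1 = except-other (λ _ → 1) v≢u
    g₂w≡1 : g₂ w ≡ 1
    g₂w≡1 = trans (except-other g₁ u≢w) (except-other (λ _ → 1) v≢w)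

  ∑-except₂ : ∀ {n} {u v : Fin n} (f : Fin n → ℕ) → u ≢ v → sum (except v (except u f)) + f v + f u ≡ sum f
  ∑-except₂ {u = u} {v} f u≢v = begin
    sum (except v (except u f)) + f v + f u         ≡⟨ cong (λ x → sum (except v (except u f)) + x + f u) (except-other f u≢v) ⟨
    sum (except v (except u f)) + except u f v + f u ≡⟨ cong (_+ f u) (∑-except v (except u f)) ⟩
    sum (except u f) + f u                           ≡⟨ ∑-except u f ⟩
    sum f                                            ∎
    where open ≡-Reasoning

  ∑-except-ind-false : ∀ {n} (v : Fin n) (c : Fin n → Bool) → (∀ z → c z ≡ false) → sum (except v (ind ∘ c)) ≡ 0
  ∑-except-ind-false {n} v c c≡false =
    trans (sum-cong-≗ (λ z → except-zero v (ind ∘ c) z (cong ind (c≡false z)))) (sum-replicate-zero n)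

  ∑-except-∧ : ∀ {n} (v : Fin n) (b : Fin n → Bool) c →
    sum (except v (λ z → ind (b z ∧ c))) ≡ ind c * sum (except v (ind ∘ b))
  ∑-except-∧ v b true  = trans (sum-cong-≗ λ z → cong (λ x → if does (v ≟ z) then 0 else ind x) (∧-identityʳ (b z)))
                               (sym (ℕP.*-identityˡ _))
  ∑-except-∧ v b false = ∑-except-ind-false v _ (λ z → ∧-zeroʳ (b z))

  does-≟-sym : ∀ {n} (y z : Fin n) → does (y ≟ z) ≡ does (z ≟ y)
  does-≟-sym y z with y ≟ z
  ... | yes y≡z = sym (dec-true (z ≟ y) (sym y≡z))
  ... | no  y≢z = sym (dec-false (z ≟ y) (y≢z ∘ sym))

module Counting where

  open import Defs
  open import Data.Bool using (Bool; true; false; if_then_else_; _∧_)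
  open import Data.Bool.Properties using (∧-zeroʳ; ∧-identityʳ)
  open import Data.Fin using (Fin)
  open import Data.Fin.Properties using (_≟_; any?)
  open import Data.Fin.Subset using (_∈_; ∁; ⁅_⁆)
  open import Data.Fin.Subset.Properties using (x∈∁p⇒x∉p; x∈⁅x⁆)
  open import Data.List using (map; allFin)
  import Data.Nat.ListAction as List
  open import Data.Nat using (ℕ; suc; _+_; _*_; _≤_; z≤n)
  import Data.Nat.Properties as ℕP
  open import Data.Nat.Tactic.RingSolver using (solve-∀)
  open import Data.Empty using (⊥; ⊥-elim)
  open import Data.Product using (∃; _×_; _,_)
  open import Function using (_∘_)
  open import Relation.Nullary using (Dec; does; ¬_; yes; no; contradiction)
  open import Relation.Nullary.Decidable using (dec-true; dec-false; decidable-stable)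
  open import Relation.Binary.PropositionalEquality
  open FinSums

  countPairs-rows : ∀ {n} (P : Fin n → Fin n → Bool) → countPairs P ≡ ∑[ y < n ] sum (except y (λ z → ind (P y z)))
  countPairs-rows {n} P =
    trans (sum-allFin n (λ y → List.sum (map (row y) (allFin n)))) (sum-cong-≗ (λ y → sum-allFin n (row y)))
    where
    row : Fin n → Fin n → ℕ
    row y = except y (λ z → ind (P y z))

  countPairs-columns : ∀ {n} (P : Fin n → Fin n → Bool) → countPairs P ≡ ∑[ z < n ] sum (except z (λ y → ind (P y z)))
  countPairs-columns {n} P = trans (countPairs-rows P) (trans (∑-comm (λ y z → except y (λ z → ind (P y z)) z))
    (sum-cong-≗ λ z → sum-cong-≗ λ y → cong (λ b → if b then 0 else ind (P y z)) (does-≟-sym y z)))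

  atTarget : ∀ {n} → (Fin n → Bool) → EdgeType n → Bool
  atTarget b (directed t) = b t
  atTarget b _            = false

  ∑-except-directedTo : ∀ {n} (v : Fin n) (b : Fin n → Bool) e → (∀ t → e ≡ directed t → v ≢ t) →
    sum (except v (λ z → ind (b z ∧ isDirectedTo z e))) ≡ ind (atTarget b e)
  ∑-except-directedTo v b none         _     = ∑-except-ind-false v _ (λ z → ∧-zeroʳ (b z))
  ∑-except-directedTo v b undirected   _     = ∑-except-ind-false v _ (λ z → ∧-zeroʳ (b z))
  ∑-except-directedTo {n} v b (directed t) v↛t = begin
    sum (except v f)          ≡⟨ ∑-concentrated t (except v f) (λ z t≢z → except-zero v f z (elsewhere z t≢z)) ⟩
    except v f t              ≡⟨ except-other f (v↛t t refl) ⟩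
    ind (b t ∧ does (t ≟ t))  ≡⟨ cong (λ x → ind (b t ∧ x)) (dec-true (t ≟ t) refl) ⟩
    ind (b t ∧ true)          ≡⟨ cong ind (∧-identityʳ (b t)) ⟩
    ind (b t)                 ∎
    where
    open ≡-Reasoning
    f : Fin n → ℕ
    f z = ind (b z ∧ does (t ≟ z))
    elsewhere : ∀ z → t ≢ z → f z ≡ 0
    elsewhere z t≢z = trans (cong (λ x → ind (b z ∧ x)) (dec-false (t ≟ z) t≢z)) (cong ind (∧-zeroʳ (b z)))

  none? : ∀ {n} (e : EdgeType n) → Dec (e ≡ none)
  none? none         = yes refl
  none? undirected   = no λ ()
  none? (directed _) = no λ ()

  isNone-≢ : ∀ {n} {e : EdgeType n} → e ≢ none → isNone e ≡ false
  isNone-≢ {e = none}       e≢none = contradiction refl e≢none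
  isNone-≢ {e = undirected} _      = refl
  isNone-≢ {e = directed _} _      = refl

  module PairCounts {k : ℕ} (F : PDG k (suc k)) where
    open Events F

    E : Fin (suc k) → EdgeType (suc k)
    E v = edge F (∁ ⁅ v ⁆)

    points-away : ∀ v t → E v ≡ directed t → v ≢ t
    points-away v t Ev↦t v≡t = x∈∁p⇒x∉p (dir-in F (∁ ⁅ v ⁆) t Ev↦t) (subst (_∈ ⁅ v ⁆) v≡t (x∈⁅x⁆ v))

    noneCount : Fin (suc k) → ℕ
    noneCount v = sum (except v (λ z → ind (isNone (E z))))

    count-xy : countPairs xy ≡ ∑[ v < suc k ] (k * ind (isUndirected (E v)))
    count-xy = trans (countPairs-columns xy) (sum-cong-≗ λ v → ∑-except-const v (ind (isUndirected (E v))))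

    count-xy̌ : countPairs xy̌ ≡ ∑[ v < suc k ] ind (atTarget (λ _ → true) (E v))
    count-xy̌ = trans (countPairs-columns xy̌)
      (sum-cong-≗ λ v → ∑-except-directedTo v (λ _ → true) (E v) (points-away v))

    count-¬xy¬xz : countPairs (¬xy and ¬xz) ≡ ∑[ v < suc k ] (ind (isNone (E v)) * noneCount v)
    count-¬xy¬xz = trans (countPairs-rows (¬xy and ¬xz))
      (sum-cong-≗ λ v → ∑-except-∧ v (λ z → isNone (E z)) (isNone (E v)))

    count-¬xyxž : countPairs (¬xy and xž) ≡ ∑[ v < suc k ] ind (atTarget (λ t → isNone (E t)) (E v))
    count-¬xyxž = trans (countPairs-rows (¬xy and xž))
      (sum-cong-≗ λ v → ∑-except-directedTo v (λ t → isNone (E t)) (E v) (points-away v))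

    count-xy̌xž : countPairs (xy̌ and xž) ≡ ∑[ v < suc k ] ind (atTarget (λ t → isDirectedTo v (E t)) (E v))
    count-xy̌xž = trans (countPairs-rows (xy̌ and xž))
      (sum-cong-≗ λ v → ∑-except-directedTo v (λ t → isDirectedTo v (E t)) (E v) (points-away v))

  module WeightedCount (j : ℕ) (F : PDG (4 + j) (5 + j)) where
    open Events F
    open PairCounts F

    k B : ℕ
    k = 4 + j
    B = 27 + 8 * j   -- = 8k − 5

    -- Each ordered pair is charged to one vertex: the pairs (y , v) of xy and xy̌ and the pairs (v , z)
    -- of the other events go to v, with the coefficients 400, 640k, 225, B² of the cleared inequality;
    -- gainOf collects the subtracted ¬xy ∧ xž term, with coefficient 30B.
    weightOf : Fin (5 + j) → EdgeType (5 + j) → ℕ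
    weightOf v none         = 225 * noneCount v
    weightOf v undirected   = 400 * k
    weightOf v (directed t) = 640 * k + B * B * ind (isDirectedTo v (E t))

    gainOf : EdgeType (5 + j) → ℕ
    gainOf (directed t) = 30 * B * ind (isNone (E t))
    gainOf _            = 0

    weight gain : Fin (5 + j) → ℕ
    weight v = weightOf v (E v)
    gain v   = gainOf (E v)

    weightOf-expand : ∀ v e → weightOf v e ≡
      400 * (k * ind (isUndirected e)) + 640 * k * ind (atTarget (λ _ → true) e)
        + 225 * (ind (isNone e) * noneCount v) + B * B * ind (atTarget (λ t → isDirectedTo v (E t)) e)
    weightOf-expand v none         = none-case k (noneCount v) B
      where
      none-case : ∀ k c B → 225 * c ≡ 400 * (k * 0) + 640 * k * 0 + 225 * (1 * c) + B * B * 0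
      none-case = solve-∀
    weightOf-expand v undirected   = undirected-case k B
      where
      undirected-case : ∀ k B → 400 * k ≡ 400 * (k * 1) + 640 * k * 0 + 225 * 0 + B * B * 0
      undirected-case = solve-∀
    weightOf-expand v (directed t) = directed-case k B (ind (isDirectedTo v (E t)))
      where
      directed-case : ∀ k B i → 640 * k + B * B * i ≡ 400 * (k * 0) + 640 * k * 1 + 225 * 0 + B * B * i
      directed-case = solve-∀

    gainOf-expand : ∀ e → gainOf e ≡ 30 * B * ind (atTarget (λ t → isNone (E t)) e)
    gainOf-expand none         = sym (ℕP.*-zeroʳ (30 * B))
    gainOf-expand undirected   = sym (ℕP.*-zeroʳ (30 * B))
    gainOf-expand (directed t) = refl

    ∑-weight : sum weight ≡ 400 * countPairs xy + 640 * k * countPairs xy̌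
                              + 225 * countPairs (¬xy and ¬xz) + B * B * countPairs (xy̌ and xž)
    ∑-weight = begin
      sum weight                              ≡⟨ sum-cong-≗ (λ v → weightOf-expand v (E v)) ⟩
      ∑[ v < 5 + j ] (a v + b v + c v + d v)  ≡⟨ ∑-distrib-+ (λ v → a v + b v + c v) d ⟩
      ∑[ v < 5 + j ] (a v + b v + c v) + sum d
        ≡⟨ cong (_+ sum d) (trans (∑-distrib-+ (λ v → a v + b v) c) (cong (_+ sum c) (∑-distrib-+ a b))) ⟩
      sum a + sum b + sum c + sum d
        ≡⟨ cong₂ _+_ (cong₂ _+_ (cong₂ _+_ (scaled 400 (λ v → k * ind (isUndirected (E v))) count-xy)
                                           (scaled (640 * k) (λ v → ind (atTarget (λ _ → true) (E v))) count-xy̌))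
                                (scaled 225 (λ v → ind (isNone (E v)) * noneCount v) count-¬xy¬xz))
                     (scaled (B * B) (λ v → ind (atTarget (λ t → isDirectedTo v (E t)) (E v))) count-xy̌xž) ⟩
      400 * countPairs xy + 640 * k * countPairs xy̌ + 225 * countPairs (¬xy and ¬xz) + B * B * countPairs (xy̌ and xž) ∎
      where
      open ≡-Reasoning
      scaled : ∀ c (f : Fin (5 + j) → ℕ) {C} → C ≡ sum f → ∑[ v < 5 + j ] (c * f v) ≡ c * C
      scaled c f C≡∑f = trans (sym (*-distribˡ-sum c f)) (cong (c *_) (sym C≡∑f))
      a b c d : Fin (5 + j) → ℕ
      a v = 400 * (k * ind (isUndirected (E v)))
      b v = 640 * k * ind (atTarget (λ _ → true) (E v))
      c v = 225 * (ind (isNone (E v)) * noneCount v)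
      d v = B * B * ind (atTarget (λ t → isDirectedTo v (E t)) (E v))

    ∑-gain : sum gain ≡ 30 * B * countPairs (¬xy and xž)
    ∑-gain = trans (sum-cong-≗ (λ v → gainOf-expand (E v)))
      (trans (sym (*-distribˡ-sum (30 * B) (λ v → ind (atTarget (λ t → isNone (E t)) (E v)))))
             (cong (30 * B *_) (sym count-¬xyxž)))

    X Y A : ℕ
    X = 640 * k + B * B
    Y = 225 * (2 + j)
    A = 400 * k + 150

    noneCount-≤ : ∀ v → 225 * noneCount v ≤ 225 * k
    noneCount-≤ v = ℕP.*-monoʳ-≤ 225 (∑-except-ind-≤ v (λ z → isNone (E z)))

    weightOf-≤-X : ∀ v e → weightOf v e ≤ X
    weightOf-≤-X v none         = ℕP.≤-trans (noneCount-≤ v) (ℕP.m≤n⇒m≤n+o (B * B) (ℕP.*-monoˡ-≤ k (ℕP.m≤m+n 225 415)))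
    weightOf-≤-X v undirected   = ℕP.m≤n⇒m≤n+o (B * B) (ℕP.*-monoˡ-≤ k (ℕP.m≤m+n 400 240))
    weightOf-≤-X v (directed t) = ℕP.+-monoʳ-≤ (640 * k)
      (ℕP.≤-trans (ℕP.*-monoʳ-≤ (B * B) (ind≤1 (isDirectedTo v (E t)))) (ℕP.≤-reflexive (ℕP.*-identityʳ (B * B))))

    NoFigure : Set
    NoFigure = ∀ {u v w} → u ≢ v → u ≢ w → v ≢ w → E u ≡ directed v → E v ≢ none → E w ≢ none → ⊥

    bound-with-bad-edge : NoFigure → ∀ {u v} → E u ≡ directed v → E v ≢ none → sum weight ≤ 400 * ((5 + j) * k)
    bound-with-bad-edge no-figure {u} {v} u↦v v≠none = ℕP.+-cancelʳ-≤ (Y + Y) _ _ (begin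
      sum weight + (Y + Y)
        ≡⟨ cong (_+ (Y + Y)) (∑-except₂ weight u≢v) ⟨
      sum (except v (except u weight)) + weight v + weight u + (Y + Y)
        ≤⟨ ℕP.+-monoˡ-≤ (Y + Y)
             (ℕP.+-mono-≤ (ℕP.+-mono-≤ (∑-mono-≤ others-≤) (weightOf-≤-X v (E v))) (weightOf-≤-X u (E u))) ⟩
      sum (except v (except u (λ _ → Y))) + X + X + (Y + Y)
        ≡⟨ swap-middle (sum (except v (except u (λ _ → Y)))) X Y ⟩
      sum (except v (except u (λ _ → Y))) + Y + Y + (X + X)
        ≡⟨ cong (_+ (X + X)) (trans (∑-except₂ (λ _ → Y) u≢v) (∑-const (5 + j) Y)) ⟩
      (5 + j) * Y + (X + X)
        ≤⟨ ℕP.m≤m+n _ _ ⟩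
      (5 + j) * Y + (X + X) + (47 * j * j + 331 * j + 72)
        ≡⟨ arithmetic j ⟩
      400 * ((5 + j) * k) + (Y + Y) ∎)
      where
      open ℕP.≤-Reasoning
      u≢v : u ≢ v
      u≢v = points-away u v u↦v
      swap-middle : ∀ s x y → s + x + x + (y + y) ≡ s + y + y + (x + x)
      swap-middle = solve-∀
      arithmetic : ∀ j → (5 + j) * (225 * (2 + j)) + ((640 * (4 + j) + (27 + 8 * j) * (27 + 8 * j))
                           + (640 * (4 + j) + (27 + 8 * j) * (27 + 8 * j))) + (47 * j * j + 331 * j + 72)
                         ≡ 400 * ((5 + j) * (4 + j)) + (225 * (2 + j) + 225 * (2 + j))
      arithmetic = solve-∀
      others-none : ∀ w → u ≢ w → v ≢ w → E w ≡ none
      others-none w u≢w v≢w = decidable-stable (none? (E w)) (no-figure u≢v u≢w v≢w u↦v v≠none)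
      other-≤ : ∀ w → u ≢ w → v ≢ w → weight w ≤ Y
      other-≤ w u≢w v≢w = begin
        weight w            ≡⟨ cong (weightOf w) (others-none w u≢w v≢w) ⟩
        225 * noneCount w   ≤⟨ ℕP.*-monoʳ-≤ 225 (∑-except-ind-≤-two-zeros (λ z → isNone (E z))
                                 (u≢w ∘ sym) (v≢w ∘ sym) u≢v (cong isNone u↦v) (isNone-≢ v≠none)) ⟩
        Y                   ∎
      others-≤ : ∀ z → except v (except u weight) z ≤ except v (except u (λ _ → Y)) z
      others-≤ z = except-≤-except v {except u weight} {except u (λ _ → Y)} z λ v≢z →
                   except-≤-except u {weight} {λ _ → Y} z λ u≢z → other-≤ z u≢z v≢z

    weightOf-≤-A+gainOf : ∀ v e → (∀ t → e ≡ directed t → E t ≡ none) → weightOf v e ≤ A + gainOf e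
    weightOf-≤-A+gainOf v none         _ = ℕP.≤-trans (noneCount-≤ v)
      (ℕP.m≤n⇒m≤n+o 0 (ℕP.m≤n⇒m≤n+o 150 (ℕP.*-monoˡ-≤ k (ℕP.m≤m+n 225 175))))
    weightOf-≤-A+gainOf v undirected   _ = ℕP.m≤n⇒m≤n+o 0 (ℕP.m≤m+n (400 * k) 150)
    weightOf-≤-A+gainOf v (directed t) t-none rewrite t-none t refl = ℕP.≤-reflexive (arithmetic j)
      where
      arithmetic : ∀ j → 640 * (4 + j) + (27 + 8 * j) * (27 + 8 * j) * 0 ≡ 400 * (4 + j) + 150 + 30 * (27 + 8 * j) * 1
      arithmetic = solve-∀

    bound-with-none : (∀ {u t} → E u ≡ directed t → E t ≡ none) → ∀ {t} → E t ≡ none →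
      sum weight ≤ 400 * ((5 + j) * k) + sum gain
    bound-with-none points-to-none {t} t-none = begin
      sum weight                                       ≡⟨ ∑-except t weight ⟨
      sum (except t weight) + weight t                 ≤⟨ ℕP.+-mono-≤ (∑-mono-≤ except-weight-≤) t-≤ ⟩
      ∑[ z < 5 + j ] (except t (λ _ → A) z + gain z) + 225 * k
        ≡⟨ cong (_+ 225 * k) (∑-distrib-+ (except t (λ _ → A)) gain) ⟩
      sum (except t (λ _ → A)) + sum gain + 225 * k    ≡⟨ cong (λ x → x + sum gain + 225 * k) (∑-except-const t A) ⟩
      k * A + sum gain + 225 * k                       ≡⟨ swap-last (k * A) (sum gain) (225 * k) ⟩
      k * A + 225 * k + sum gain
        ≤⟨ ℕP.+-monoˡ-≤ (sum gain) (ℕP.≤-trans (ℕP.m≤m+n _ (25 * k)) (ℕP.≤-reflexive (arithmetic j))) ⟩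
      400 * ((5 + j) * k) + sum gain                   ∎
      where
      open ℕP.≤-Reasoning
      swap-last : ∀ a b c → a + b + c ≡ a + c + b
      swap-last = solve-∀
      arithmetic : ∀ j → (4 + j) * (400 * (4 + j) + 150) + 225 * (4 + j) + 25 * (4 + j) ≡ 400 * ((5 + j) * (4 + j))
      arithmetic = solve-∀
      t-≤ : weight t ≤ 225 * k
      t-≤ = subst (_≤ 225 * k) (cong (weightOf t) (sym t-none)) (noneCount-≤ t)
      except-weight-≤ : ∀ z → except t weight z ≤ except t (λ _ → A) z + gain z
      except-weight-≤ z with t ≟ z
      ... | yes _ = z≤n
      ... | no  _ = weightOf-≤-A+gainOf z (E z) (λ _ → points-to-none)

    sum-weight-all-undirected : (∀ v → E v ≡ undirected) → sum weight ≡ 400 * ((5 + j) * k)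
    sum-weight-all-undirected undirected-everywhere = begin
      sum weight                ≡⟨ sum-cong-≗ (λ v → cong (weightOf v) (undirected-everywhere v)) ⟩
      ∑[ v < 5 + j ] (400 * k)  ≡⟨ ∑-const (5 + j) (400 * k) ⟩
      (5 + j) * (400 * k)       ≡⟨ reorder (5 + j) k ⟩
      400 * ((5 + j) * k)       ∎
      where
      open ≡-Reasoning
      reorder : ∀ n k → n * (400 * k) ≡ 400 * (n * k)
      reorder = solve-∀

    BadEdgeAt : Fin (5 + j) → Set
    BadEdgeAt u = ∃ λ v → E u ≡ directed v × E v ≢ none

    bad-edge-at? : ∀ u → Dec (BadEdgeAt u)
    bad-edge-at? u with E u
    ... | none       = no λ { (_ , () , _) }
    ... | undirected = no λ { (_ , () , _) }
    ... | directed v with none? (E v)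
    ...   | yes v-none = no λ { (_ , refl , v≠none) → v≠none v-none }
    ...   | no  v≠none = yes (v , refl , v≠none)

    module _ (no-bad-edge : ∀ u → ¬ BadEdgeAt u) where

      points-to-none : ∀ {u t} → E u ≡ directed t → E t ≡ none
      points-to-none {u} {t} u↦t = decidable-stable (none? (E t)) λ t≠none → no-bad-edge u (t , u↦t , t≠none)

      undirected-everywhere : (∀ v → E v ≢ none) → ∀ v → E v ≡ undirected
      undirected-everywhere no-none v with E v in eq
      ... | none       = ⊥-elim (no-none v eq)
      ... | undirected = refl
      ... | directed t = ⊥-elim (no-none t (points-to-none eq))

    weighted-bound : NoFigure → sum weight ≤ 400 * ((5 + j) * k) + sum gain
    weighted-bound no-figure with any? bad-edge-at?
    ... | yes (u , v , u↦v , v≠none) = ℕP.m≤n⇒m≤n+o (sum gain) (bound-with-bad-edge no-figure u↦v v≠none)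
    ... | no  no-bad-edge with any? (λ t → none? (E t))
    ...   | yes (t , t-none) = bound-with-none (points-to-none (λ u bad → no-bad-edge (u , bad))) t-none
    ...   | no  no-none      = ℕP.m≤n⇒m≤n+o (sum gain) (ℕP.≤-reflexive (sum-weight-all-undirected
              (undirected-everywhere (λ u bad → no-bad-edge (u , bad)) (λ t t-none → no-none (t , t-none)))))

    pair-count-bound : NoFigure →
      400 * countPairs xy + 640 * k * countPairs xy̌ + 225 * countPairs (¬xy and ¬xz) + B * B * countPairs (xy̌ and xž)
        ≤ 400 * ((5 + j) * k) + 30 * B * countPairs (¬xy and xž)
    pair-count-bound no-figure = subst₂ _≤_ ∑-weight (cong (400 * ((5 + j) * k) +_) ∑-gain) (weighted-bound no-figure)

module Embedding where

  open import Defs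
  open import Data.Bool using (true)
  open import Data.Nat using (ℕ; suc)
  open import Data.Fin using (Fin; zero; fromℕ; inject₁)
  open import Data.Fin.Properties using (_≟_; any?; fromℕ≢inject₁)
  open import Data.Fin.Permutation using (Permutation′; _⟨$⟩ʳ_; _⟨$⟩ˡ_; inverseˡ; inverseʳ; transpose; _∘ₚ_)
  import Data.Fin.Permutation.Components as PC
  open import Data.Fin.Subset using (Subset; _∈_; ∁; ⁅_⁆)
  open import Data.Fin.Subset.Properties using (_∈?_; x∉p⇒x∈∁p; x∈∁p⇒x∉p; x∈⁅y⁆⇒x≡y; x∈⁅x⁆; ⊆-antisym)
  open import Data.Vec.Properties using (lookup∘tabulate; []=⇒lookup; lookup⇒[]=)
  open import Data.Product using (Σ; ∃; _×_; _,_)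
  open import Data.Unit using (tt)
  open import Function using (_∘_)
  open import Relation.Nullary using (Dec; does; yes; no)
  open import Relation.Nullary.Decidable using (_×-dec_; dec-true; dec-false)
  open import Relation.Binary.PropositionalEquality

  module _ {n : ℕ} where

    transpose-matchˡ : ∀ (i j : Fin n) → PC.transpose i j i ≡ j
    transpose-matchˡ i j rewrite dec-true (i ≟ i) refl = refl

    transpose-other : ∀ {i j k : Fin n} → k ≢ i → k ≢ j → PC.transpose i j k ≡ k
    transpose-other {i} {j} {k} k≢i k≢j rewrite dec-false (k ≟ i) k≢i | dec-false (k ≟ j) k≢j = refl

    ⟨$⟩ʳ-injective : ∀ (π : Permutation′ n) {x y} → π ⟨$⟩ʳ x ≡ π ⟨$⟩ʳ y → x ≡ y
    ⟨$⟩ʳ-injective π {x} {y} eq = trans (sym (inverseˡ π)) (trans (cong (π ⟨$⟩ˡ_) eq) (inverseˡ π))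

    move-three : ∀ {a₁ a₂ a₃ b₁ b₂ b₃ : Fin n} →
      a₁ ≢ a₂ → a₁ ≢ a₃ → a₂ ≢ a₃ → b₁ ≢ b₂ → b₁ ≢ b₃ → b₂ ≢ b₃ →
      Σ (Permutation′ n) λ π → π ⟨$⟩ʳ a₁ ≡ b₁ × π ⟨$⟩ʳ a₂ ≡ b₂ × π ⟨$⟩ʳ a₃ ≡ b₃
    move-three {a₁} {a₂} {a₃} {b₁} {b₂} {b₃} a₁≢a₂ a₁≢a₃ a₂≢a₃ b₁≢b₂ b₁≢b₃ b₂≢b₃ =
      π₁ ∘ₚ π₂ ∘ₚ π₃ , π₁₂₃a₁ , π₁₂₃a₂ , transpose-matchˡ x₃ b₃
      where
      π₁ π₂ π₃ : Permutation′ n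
      π₁ = transpose a₁ b₁
      π₂ = transpose (π₁ ⟨$⟩ʳ a₂) b₂
      x₃ : Fin n
      x₃ = (π₁ ∘ₚ π₂) ⟨$⟩ʳ a₃
      π₃ = transpose x₃ b₃
      π₁₂a₁ : (π₁ ∘ₚ π₂) ⟨$⟩ʳ a₁ ≡ b₁
      π₁₂a₁ = trans (cong (π₂ ⟨$⟩ʳ_) (transpose-matchˡ a₁ b₁))
        (transpose-other (λ b₁≡π₁a₂ → a₁≢a₂ (⟨$⟩ʳ-injective π₁ (trans (transpose-matchˡ a₁ b₁) b₁≡π₁a₂))) b₁≢b₂)
      π₁₂a₂ : (π₁ ∘ₚ π₂) ⟨$⟩ʳ a₂ ≡ b₂
      π₁₂a₂ = transpose-matchˡ (π₁ ⟨$⟩ʳ a₂) b₂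
      π₁₂₃a₁ : (π₁ ∘ₚ π₂ ∘ₚ π₃) ⟨$⟩ʳ a₁ ≡ b₁
      π₁₂₃a₁ = trans (cong (π₃ ⟨$⟩ʳ_) π₁₂a₁)
        (transpose-other (λ b₁≡x₃ → a₁≢a₃ (⟨$⟩ʳ-injective (π₁ ∘ₚ π₂) (trans π₁₂a₁ b₁≡x₃))) b₁≢b₃)
      π₁₂₃a₂ : (π₁ ∘ₚ π₂ ∘ₚ π₃) ⟨$⟩ʳ a₂ ≡ b₂
      π₁₂₃a₂ = trans (cong (π₃ ⟨$⟩ʳ_) π₁₂a₂)
        (transpose-other (λ b₂≡x₃ → a₂≢a₃ (⟨$⟩ʳ-injective (π₁ ∘ₚ π₂) (trans π₁₂a₂ b₂≡x₃))) b₂≢b₃)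

  module _ {n : ℕ} (φ : Fin n → Fin n) where

    ∈-image⁻ : ∀ {S j} → j ∈ image φ S → ∃ λ i → φ i ≡ j × i ∈ S
    ∈-image⁻ {S} {j} j∈ = witness (any? (λ i → φ i ≟ j ×-dec i ∈? S))
      (trans (sym (lookup∘tabulate _ j)) ([]=⇒lookup j∈))
      where
      witness : ∀ {P : Set} (P? : Dec P) → does P? ≡ true → P
      witness (yes p) _ = p

    ∈-image⁺ : ∀ {S i} → i ∈ S → φ i ∈ image φ S
    ∈-image⁺ {S} {i} i∈S = lookup⇒[]= (φ i) _
      (trans (lookup∘tabulate _ (φ i)) (dec-true (any? (λ i′ → φ i′ ≟ φ i ×-dec i′ ∈? S)) (i , refl , i∈S)))

  image-∁⁅⁆ : ∀ {n} (π : Permutation′ n) x → image (π ⟨$⟩ʳ_) (∁ ⁅ x ⁆) ≡ ∁ ⁅ π ⟨$⟩ʳ x ⁆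
  image-∁⁅⁆ π x = ⊆-antisym ⊆ ⊇
    where
    ⊆ : ∀ {j} → j ∈ image (π ⟨$⟩ʳ_) (∁ ⁅ x ⁆) → j ∈ ∁ ⁅ π ⟨$⟩ʳ x ⁆
    ⊆ j∈ with ∈-image⁻ (π ⟨$⟩ʳ_) j∈
    ... | i , refl , i∈ = x∉p⇒x∈∁p λ πi∈ →
      x∈∁p⇒x∉p i∈ (subst (_∈ ⁅ x ⁆) (sym (⟨$⟩ʳ-injective π (x∈⁅y⁆⇒x≡y _ πi∈))) (x∈⁅x⁆ x))
    ⊇ : ∀ {j} → j ∈ ∁ ⁅ π ⟨$⟩ʳ x ⁆ → j ∈ image (π ⟨$⟩ʳ_) (∁ ⁅ x ⁆)
    ⊇ {j} j∈ = subst (_∈ image (π ⟨$⟩ʳ_) (∁ ⁅ x ⁆)) (inverseʳ π) (∈-image⁺ (π ⟨$⟩ʳ_) (x∉p⇒x∈∁p λ π⁻¹j∈ →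
      x∈∁p⇒x∉p j∈ (subst (_∈ ⁅ π ⟨$⟩ʳ x ⁆)
                         (trans (cong (π ⟨$⟩ʳ_) (sym (x∈⁅y⁆⇒x≡y x π⁻¹j∈))) (inverseʳ π)) (x∈⁅x⁆ _))))

  data T-edge-View (m : ℕ) (S : Subset (suc (suc m))) : EdgeType (suc (suc m)) → Set where
    directed-edge  : S ≡ ∁ ⁅ inject₁ (fromℕ m) ⁆ → T-edge-View m S (directed (fromℕ (suc m)))
    undirected-top : S ≡ ∁ ⁅ fromℕ (suc m) ⁆ → T-edge-View m S undirected
    undirected-bot : S ≡ ∁ ⁅ zero ⁆ → T-edge-View m S undirected
    no-edge        : T-edge-View m S none

  T-edge-view : ∀ m S → T-edge-View m S (T-edge m S)
  T-edge-view m S with S ≟ₛ ∁ ⁅ inject₁ (fromℕ m) ⁆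
  ... | yes eq = directed-edge eq
  ... | no _ with S ≟ₛ ∁ ⁅ fromℕ (suc m) ⁆
  ...   | yes eq = undirected-top eq
  ...   | no _ with S ≟ₛ ∁ ⁅ zero ⁆
  ...     | yes eq = undirected-bot eq
  ...     | no _   = no-edge

  T⃗-⊑ : ∀ {m} (F : PDG (suc (suc m)) (suc (suc (suc m)))) {u v w} →
    u ≢ v → u ≢ w → v ≢ w →
    edge F (∁ ⁅ u ⁆) ≡ directed v → edge F (∁ ⁅ v ⁆) ≢ none → edge F (∁ ⁅ w ⁆) ≢ none →
    T⃗ (suc (suc m)) ⊑ F
  T⃗-⊑ {m} F {u} {v} {w} u≢v u≢w v≢w u↦v v≠none w≠none =
    embed (move-three (fromℕ≢inject₁ ∘ sym) (λ ()) (λ ()) u≢v u≢w v≢w)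
    where
    vK vLast : Fin (suc (suc (suc m)))
    vK    = inject₁ (fromℕ (suc m))
    vLast = fromℕ (suc (suc m))
    embed : (Σ (Permutation′ (suc (suc (suc m)))) λ π →
               π ⟨$⟩ʳ vK ≡ u × π ⟨$⟩ʳ vLast ≡ v × π ⟨$⟩ʳ zero ≡ w) →
            T⃗ (suc (suc m)) ⊑ F
    embed (π , πvK≡u , πvLast≡v , π0≡w) = π ⟨$⟩ʳ_ , ⟨$⟩ʳ-injective π , λ S _ → realise S (T-edge-view (suc m) S)
      where
      edge-image : ∀ x {y} → π ⟨$⟩ʳ x ≡ y → edge F (image (π ⟨$⟩ʳ_) (∁ ⁅ x ⁆)) ≡ edge F (∁ ⁅ y ⁆)
      edge-image x refl = cong (edge F) (image-∁⁅⁆ π x)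
      realise : ∀ S {e} → T-edge-View (suc m) S e → Realised (π ⟨$⟩ʳ_) e (edge F (image (π ⟨$⟩ʳ_) S))
      realise S (directed-edge refl)  = trans (edge-image vK πvK≡u) (trans u↦v (cong directed (sym πvLast≡v)))
      realise S (undirected-top refl) = v≠none ∘ trans (sym (edge-image vLast πvLast≡v))
      realise S (undirected-bot refl) = w≠none ∘ trans (sym (edge-image zero π0≡w))
      realise S no-edge               = tt

module Scaling where

  open import Defs using (log₂3<_)
  open import Data.Nat as ℕ using (ℕ; suc)
  import Data.Nat.Properties as ℕP
  open import Data.Integer as ℤ using (+_)
  import Data.Integer.Properties as ℤP
  open import Data.Rational
  open import Data.Rational.Properties
  import Data.Rational.Unnormalised as ℚᵘ
  import Data.Rational.Unnormalised.Properties as ℚᵘP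
  open import Data.Rational.Solver using (module +-*-Solver)
  open import Data.Product using (_,_)
  open import Data.Unit using (tt)
  open import Relation.Nullary.Decidable using (toWitness)
  open import Relation.Binary.PropositionalEquality

  ι : ℕ → ℚ
  ι n = + n / 1

  toℚᵘ-/ : ∀ m d .{{_ : ℕ.NonZero d}} → toℚᵘ (+ m / d) ℚᵘ.≃ ℚᵘ.mkℚᵘ (+ m) (ℕ.pred d)
  toℚᵘ-/ m (suc d) = toℚᵘ-fromℚᵘ (ℚᵘ.mkℚᵘ (+ m) d)

  ι-+ : ∀ m n → ι (m ℕ.+ n) ≡ ι m + ι n
  ι-+ m n = toℚᵘ-injective (begin
    toℚᵘ (ι (m ℕ.+ n))                        ≈⟨ toℚᵘ-/ (m ℕ.+ n) 1 ⟩
    ℚᵘ.mkℚᵘ (+ (m ℕ.+ n)) 0                   ≈⟨ ℚᵘ.*≡* eq ⟩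
    ℚᵘ.mkℚᵘ (+ m) 0 ℚᵘ.+ ℚᵘ.mkℚᵘ (+ n) 0     ≈⟨ ℚᵘP.+-cong (toℚᵘ-/ m 1) (toℚᵘ-/ n 1) ⟨
    toℚᵘ (ι m) ℚᵘ.+ toℚᵘ (ι n)                ≈⟨ toℚᵘ-homo-+ (ι m) (ι n) ⟨
    toℚᵘ (ι m + ι n)                          ∎)
    where
    open ℚᵘP.≃-Reasoning
    eq : + (m ℕ.+ n) ℤ.* + 1 ≡ ((+ m ℤ.* + 1) ℤ.+ (+ n ℤ.* + 1)) ℤ.* + 1
    eq rewrite ℤP.*-identityʳ (+ m) | ℤP.*-identityʳ (+ n) | ℤP.pos-+ m n = refl

  ι-* : ∀ m n → ι (m ℕ.* n) ≡ ι m * ι n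
  ι-* m n = toℚᵘ-injective (begin
    toℚᵘ (ι (m ℕ.* n))                        ≈⟨ toℚᵘ-/ (m ℕ.* n) 1 ⟩
    ℚᵘ.mkℚᵘ (+ (m ℕ.* n)) 0                   ≈⟨ ℚᵘ.*≡* (cong (ℤ._* + 1) (ℤP.pos-* m n)) ⟩
    ℚᵘ.mkℚᵘ (+ m) 0 ℚᵘ.* ℚᵘ.mkℚᵘ (+ n) 0     ≈⟨ ℚᵘP.*-cong (toℚᵘ-/ m 1) (toℚᵘ-/ n 1) ⟨
    toℚᵘ (ι m) ℚᵘ.* toℚᵘ (ι n)                ≈⟨ toℚᵘ-homo-* (ι m) (ι n) ⟨
    toℚᵘ (ι m * ι n)                          ∎)
    where open ℚᵘP.≃-Reasoning

  ι-mono-≤ : ∀ {m n} → m ℕ.≤ n → ι m ≤ ι n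
  ι-mono-≤ {m} {n} m≤n = toℚᵘ-cancel-≤
    (ℚᵘP.≤-respʳ-≃ (ℚᵘP.≃-sym (toℚᵘ-/ n 1)) (ℚᵘP.≤-respˡ-≃ (ℚᵘP.≃-sym (toℚᵘ-/ m 1))
      (ℚᵘ.*≤* (ℤP.*-monoʳ-≤-nonNeg (+ 1) (ℤ.+≤+ m≤n)))))

  /-as-ι : ∀ m d .{{_ : ℕ.NonZero d}} → + m / d ≡ ι m * (+ 1 / d)
  /-as-ι m (suc d) = toℚᵘ-injective (begin
    toℚᵘ (+ m / suc d)                                 ≈⟨ toℚᵘ-/ m (suc d) ⟩
    ℚᵘ.mkℚᵘ (+ m) d                                    ≈⟨ ℚᵘ.*≡* eq ⟩
    ℚᵘ.mkℚᵘ (+ m) 0 ℚᵘ.* ℚᵘ.mkℚᵘ (+ 1) d              ≈⟨ ℚᵘP.*-cong (toℚᵘ-/ m 1) (toℚᵘ-/ 1 (suc d)) ⟨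
    toℚᵘ (ι m) ℚᵘ.* toℚᵘ (+ 1 / suc d)                 ≈⟨ toℚᵘ-homo-* (ι m) (+ 1 / suc d) ⟨
    toℚᵘ (ι m * (+ 1 / suc d))                         ∎)
    where
    open ℚᵘP.≃-Reasoning
    eq : + m ℤ.* + (1 ℕ.* suc d) ≡ (+ m ℤ.* + 1) ℤ.* + suc d
    eq rewrite ℕP.*-identityˡ (suc d) | ℤP.*-identityʳ (+ m) = refl

  ι-*-1/ : ∀ d .{{_ : ℕ.NonZero d}} → ι d * (+ 1 / d) ≡ 1ℚ
  ι-*-1/ (suc d) = trans (sym (/-as-ι (suc d) (suc d)))
    (toℚᵘ-injective (ℚᵘP.≃-trans (toℚᵘ-/ (suc d) (suc d)) (ℚᵘ.*≡* (ℤP.*-comm (+ suc d) (+ 1)))))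

  θ₀ a₀ : ℚ
  θ₀ = + 8 / 5
  a₀ = + 3 / 4

  b₀ : ℕ → ℚ
  b₀ B = + B / 20

  log₂3<θ₀ : log₂3< θ₀
  log₂3<θ₀ = 8 , refl , toWitness {a? = 3 ℕ.^ 5 ℕ.<? 2 ℕ.^ 8} tt

  -- Multiplying by 400 D clears every denominator: 400 k θ₀ = 640 k, 400 a₀² = 225,
  -- 400 · 2 a₀ (b₀ B) = 30 B and 400 (b₀ B)² = B².
  scaled-bound : ∀ k B D .{{_ : ℕ.NonZero D}} C₁ C₂ C₃ C₄ C₅ →
    400 ℕ.* C₁ ℕ.+ 640 ℕ.* k ℕ.* C₂ ℕ.+ 225 ℕ.* C₃ ℕ.+ B ℕ.* B ℕ.* C₅ ℕ.≤ 400 ℕ.* D ℕ.+ 30 ℕ.* B ℕ.* C₄ →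
    + C₁ / D + ((+ k / 1) * θ₀) * (+ C₂ / D) + (a₀ * a₀) * (+ C₃ / D)
      - ((+ 2 / 1) * a₀ * b₀ B) * (+ C₄ / D) + (b₀ B * b₀ B) * (+ C₅ / D) ≤ 1ℚ
  scaled-bound k B D C₁ C₂ C₃ C₄ C₅ L≤R = begin
    + C₁ / D + (κ * θ₀) * (+ C₂ / D) + (a₀ * a₀) * (+ C₃ / D)
      - ((+ 2 / 1) * a₀ * b₀ B) * (+ C₄ / D) + (b₀ B * b₀ B) * (+ C₅ / D)
        ≡⟨ cong₂ _+_ (cong₂ _-_ (cong₂ _+_ (cong₂ _+_ (/-as-ι C₁ D) (cong (κ * θ₀ *_) (/-as-ι C₂ D)))
                                           (cong (a₀ * a₀ *_) (/-as-ι C₃ D)))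
                                (cong₂ _*_ (cong ((+ 2 / 1) * a₀ *_) (/-as-ι B 20)) (/-as-ι C₄ D)))
                     (cong₂ _*_ (cong₂ _*_ (/-as-ι B 20) (/-as-ι B 20)) (/-as-ι C₅ D)) ⟩
    c₁ * r + (κ * θ₀) * (c₂ * r) + (a₀ * a₀) * (c₃ * r)
      - ((+ 2 / 1) * a₀ * (β * (+ 1 / 20))) * (c₄ * r) + ((β * (+ 1 / 20)) * (β * (+ 1 / 20))) * (c₅ * r)
        ≡⟨ expand c₁ c₂ c₃ c₄ c₅ κ β r ⟩
    (+ 1 / 400) * ((((+ 400 / 1) * c₁ + (+ 640 / 1) * κ * c₂ + (+ 225 / 1) * c₃ + β * β * c₅) - (+ 30 / 1) * β * c₄) * r)
        ≡⟨ cong (λ x → (+ 1 / 400) * (x * r)) (cong₂ _-_ ι-L ι-R) ⟨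
    (+ 1 / 400) * ((ι L - ι R) * r)
        ≤⟨ *-monoˡ-≤-nonNeg (+ 1 / 400) (*-monoʳ-≤-nonNeg r {{normalize-nonNeg 1 D}} ιL-ιR≤) ⟩
    (+ 1 / 400) * (ι (400 ℕ.* D) * r)
        ≡⟨ cong (λ x → (+ 1 / 400) * (x * r)) (ι-* 400 D) ⟩
    (+ 1 / 400) * ((+ 400 / 1) * ι D * r)
        ≡⟨ solve 2 (λ d r → con (+ 1 / 400) :* ((con (+ 400 / 1) :* d) :* r) := d :* r) refl (ι D) r ⟩
    ι D * r
        ≡⟨ ι-*-1/ D ⟩
    1ℚ ∎
    where
    open ≤-Reasoning
    open +-*-Solver
    κ r β c₁ c₂ c₃ c₄ c₅ : ℚ
    κ = + k / 1
    r = + 1 / D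
    β = ι B
    c₁ = ι C₁
    c₂ = ι C₂
    c₃ = ι C₃
    c₄ = ι C₄
    c₅ = ι C₅
    L R : ℕ
    L = 400 ℕ.* C₁ ℕ.+ 640 ℕ.* k ℕ.* C₂ ℕ.+ 225 ℕ.* C₃ ℕ.+ B ℕ.* B ℕ.* C₅
    R = 30 ℕ.* B ℕ.* C₄
    ι-*₃ : ∀ x y z → ι (x ℕ.* y ℕ.* z) ≡ ι x * ι y * ι z
    ι-*₃ x y z = trans (ι-* (x ℕ.* y) z) (cong (_* ι z) (ι-* x y))
    ι-L : ι L ≡ (+ 400 / 1) * c₁ + (+ 640 / 1) * κ * c₂ + (+ 225 / 1) * c₃ + β * β * c₅
    ι-L = begin-equality
      ι L                                                          ≡⟨ ι-+ (400 ℕ.* C₁ ℕ.+ 640 ℕ.* k ℕ.* C₂ ℕ.+ 225 ℕ.* C₃) _ ⟩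
      ι (400 ℕ.* C₁ ℕ.+ 640 ℕ.* k ℕ.* C₂ ℕ.+ 225 ℕ.* C₃) + ι (B ℕ.* B ℕ.* C₅)
        ≡⟨ cong₂ _+_ (ι-+ (400 ℕ.* C₁ ℕ.+ 640 ℕ.* k ℕ.* C₂) _) (ι-*₃ B B C₅) ⟩
      ι (400 ℕ.* C₁ ℕ.+ 640 ℕ.* k ℕ.* C₂) + ι (225 ℕ.* C₃) + β * β * c₅
        ≡⟨ cong₂ (λ x y → x + y + β * β * c₅) (ι-+ (400 ℕ.* C₁) _) (ι-* 225 C₃) ⟩
      ι (400 ℕ.* C₁) + ι (640 ℕ.* k ℕ.* C₂) + (+ 225 / 1) * c₃ + β * β * c₅
        ≡⟨ cong₂ (λ x y → x + y + (+ 225 / 1) * c₃ + β * β * c₅) (ι-* 400 C₁) (ι-*₃ 640 k C₂) ⟩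
      (+ 400 / 1) * c₁ + (+ 640 / 1) * κ * c₂ + (+ 225 / 1) * c₃ + β * β * c₅ ∎
    ι-R : ι R ≡ (+ 30 / 1) * β * c₄
    ι-R = ι-*₃ 30 B C₄
    ιL-ιR≤ : ι L - ι R ≤ ι (400 ℕ.* D)
    ιL-ιR≤ = begin
      ι L - ι R                    ≤⟨ +-monoˡ-≤ (- ι R) (ι-mono-≤ L≤R) ⟩
      ι (400 ℕ.* D ℕ.+ R) - ι R    ≡⟨ cong (_- ι R) (ι-+ (400 ℕ.* D) R) ⟩
      ι (400 ℕ.* D) + ι R - ι R    ≡⟨ solve 2 (λ x y → x :+ y :- y := x) refl (ι (400 ℕ.* D)) (ι R) ⟩
      ι (400 ℕ.* D)                ∎
    expand : ∀ c₁ c₂ c₃ c₄ c₅ κ β r →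
      c₁ * r + (κ * θ₀) * (c₂ * r) + (a₀ * a₀) * (c₃ * r)
        - ((+ 2 / 1) * a₀ * (β * (+ 1 / 20))) * (c₄ * r) + ((β * (+ 1 / 20)) * (β * (+ 1 / 20))) * (c₅ * r)
      ≡ (+ 1 / 400) * ((((+ 400 / 1) * c₁ + (+ 640 / 1) * κ * c₂ + (+ 225 / 1) * c₃ + β * β * c₅) - (+ 30 / 1) * β * c₄) * r)
    expand = solve 8 (λ c₁ c₂ c₃ c₄ c₅ κ β r →
        c₁ :* r :+ (κ :* con θ₀) :* (c₂ :* r) :+ (con a₀ :* con a₀) :* (c₃ :* r)
          :- (con (+ 2 / 1) :* con a₀ :* (β :* con (+ 1 / 20))) :* (c₄ :* r)
          :+ ((β :* con (+ 1 / 20)) :* (β :* con (+ 1 / 20))) :* (c₅ :* r)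
        := con (+ 1 / 400) :* ((((con (+ 400 / 1) :* c₁ :+ con (+ 640 / 1) :* κ :* c₂ :+ con (+ 225 / 1) :* c₃ :+ β :* β :* c₅))
                                :- con (+ 30 / 1) :* β :* c₄) :* r)) refl

open import Defs
open import Data.Nat as ℕ using (ℕ)
open import Data.Integer using (+_)
open import Data.Rational using (ℚ; _/_; _+_; _-_; _*_; _≤_; 1ℚ)
open import Data.Product using (Σ; _×_; _,_)

lemma2p4 : (k : ℕ) → 4 ℕ.≤ k →
    Σ ℚ λ θ → Σ ℚ λ a → Σ ℚ λ b → log₂3< θ ×
      ((F : PDG k (ℕ.suc k)) → (F -free) (T⃗ k) →
        let open Events F in
        Pr xy + ((+ k / 1) * θ) * Pr xy̌
          + (a * a) * Pr (¬xy and ¬xz)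
          - ((+ 2 / 1) * a * b) * Pr (¬xy and xž)
          + (b * b) * Pr (xy̌ and xž)
          ≤ 1ℚ)
lemma2p4 .(4 ℕ.+ j) (ℕ.s≤s (ℕ.s≤s (ℕ.s≤s (ℕ.s≤s {n = j} ℕ.z≤n)))) =
  θ₀ , a₀ , b₀ (27 ℕ.+ 8 ℕ.* j) , log₂3<θ₀ , λ F F-free →
    let open Events F
        open WeightedCount j F
    in scaled-bound k B ((5 ℕ.+ j) ℕ.* k)
         (countPairs xy) (countPairs xy̌) (countPairs (¬xy and ¬xz)) (countPairs (¬xy and xž)) (countPairs (xy̌ and xž))
         (pair-count-bound λ u≢v u≢w v≢w u↦v v≠none w≠none → F-free (T⃗-⊑ F u≢v u≢w v≢w u↦v v≠none w≠none))
  where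
  open Embedding using (T⃗-⊑)
  open Counting using (module WeightedCount)
  open Scaling using (θ₀; a₀; b₀; log₂3<θ₀; scaled-bound)
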